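{- Let $\mathcal C$ be a category, $n\ge0$ and $0\le i\le n$. Let $f:A\to B$ be a zigzag map in $Z(\mathcal C)$ from a zigzag $A$ of length $n$ to a zigzag $B$ of length $n+1$ whose singular map is the face map $d_i:[n]\to[n+1]$. (Its regular slices are then $f(r_k):A(r_k)\to B(r_k)$ for $k\le i$ and $f(r_k):A(r_{k-1})\to B(r_k)$ for $k\ge i+1$, and its singular slices are $f(s_j):A(s_j)\to B(s_{d_i(j)})$.) Then $f$ is $\pi$-cartesian (for $\pi:Z(\mathcal C)\to\Delta_+$) if and only if all singular slices $f(s_j)$, $0\le j<n$, and all regular slices $f(r_k)$ with $k\notin\{i,i+1\}$ are isomorphisms in $\mathcal C$, and the square formed by $f(r_i):A(r_i)\to B(r_i)$, $f(r_{i+1}):A(r_i)\to B(r_{i+1})$ and the cospan $B(r_i)\to B(s_i)\leftarrow B(r_{i+1})$ is a pullback square in $\mathcal C$.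
   Context: For $n\ge0$, $[n]=\{0,\dots,n-1\}$; $\Delta_+$ is the category of these finite total orders and order-preserving maps. The face map $d_i:[n]\to[n+1]$ is the unique injective order-preserving map whose image omits $i$. For order-preserving $f:[n]\to[m]$ define $f^\flat:[m+1]\to[n+1]$ by $f^\flat(i)=\min(\{j\in[n]: f(j)\ge i\}\cup\{n\})$. A zigzag $X$ of length $n$ in a category $\mathcal C$ consists of regular objects $X(r_0),\dots,X(r_n)$, singular objects $X(s_0),\dots,X(s_{n-1})$ and cospans $X(r_i)\to X(s_i)\leftarrow X(r_{i+1})$. A zigzag map $f:X\to Y$ ($X$ of length $n$, $Y$ of length $m$) consists of an order-preserving singular map $f_s:[n]\to[m]$, with regular map $f_r:=f_s^\flat$, regular slices $f(r_i):X(r_{f_r(i)})\to Y(r_i)$ ($0\le i\le m$) and singular slices $f(s_j):X(s_j)\to Y(s_{f_s(j)})$ ($0\le j<n$), such that for each $0\le i<m$: (a) if $f_s^{ -1}(i)$ is nonempty with least element $p$ and greatest $q$, then $f(s_p)\circ(X(r_p)\to X(s_p))=(Y(r_i)\to Y(s_i))\circ f(r_i)$, $f(s_q)\circ(X(r_{q+1})\to X(s_q))=(Y(r_{i+1})\to Y(s_i))\circ f(r_{i+1})$, and $f(s_j)\circ(X(r_{j+1})\to X(s_j))=f(s_{j+1})\circ(X(r_{j+1})\to X(s_{j+1}))$ for $p\le j<q$; (b) if $f_s^{ -1}(i)=\emptyset$, then $(Y(r_i)\to Y(s_i))\circ f(r_i)=(Y(r_{i+1})\to Y(s_i))\circ f(r_{i+1})$.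 Composition: $(g\circ f)_s=g_s\circ f_s$, $(g\circ f)(s_j)=g(s_{f_s(j)})\circ f(s_j)$, $(g\circ f)(r_i)=g(r_i)\circ f(r_{g_r(i)})$. This gives the category $Z(\mathcal C)$. The functor $\pi:Z(\mathcal C)\to\Delta_+$ sends a zigzag of length $n$ to $[n]$ and $f$ to $f_s$. For a functor $p:\mathcal A\to\mathcal B$, a map $f:x\to y$ in $\mathcal A$ is $p$-cartesian if for every $h:x'\to y$ and every $u:p(x')\to p(x)$ with $p(h)=p(f)\circ u$ there is a unique $v:x'\to x$ with $f\circ v=h$ and $p(v)=u$. -}

module Defs where

open import Level using (Level; _⊔_) renaming (suc to lsuc)
open import Data.Nat as ℕ using (ℕ; zero; suc)
open import Data.Fin using (Fin; zero; suc; toℕ; inject₁; punchIn; _≤_; _<_)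
open import Data.Product using (Σ; _×_; _,_)
open import Relation.Binary using (Rel; IsEquivalence)
open import Relation.Binary.PropositionalEquality using (_≡_; _≢_; subst; subst₂)
open import Relation.Nullary using (yes; no)

record Category (o ℓ e : Level) : Set (lsuc (o ⊔ ℓ ⊔ e)) where
  infixr 9 _∘_
  infix 4 _≈_
  field
    Obj : Set o
    Hom : Obj → Obj → Set ℓ
    _≈_ : ∀ {A B} → Rel (Hom A B) e
    id : ∀ {A} → Hom A A
    _∘_ : ∀ {A B C} → Hom B C → Hom A B → Hom A C
    ≈-equiv : ∀ {A B} → IsEquivalence (_≈_ {A} {B})
    assoc : ∀ {A B C D} {f : Hom A B} {g : Hom B C} {h : Hom C D} →
            (h ∘ g) ∘ f ≈ h ∘ (g ∘ f)
    identityˡ : ∀ {A B} {f : Hom A B} → id ∘ f ≈ f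
    identityʳ : ∀ {A B} {f : Hom A B} → f ∘ id ≈ f
    ∘-resp-≈ : ∀ {A B C} {f h : Hom B C} {g i : Hom A B} →
               f ≈ h → g ≈ i → f ∘ g ≈ h ∘ i

-- Δ₊ : order-preserving maps [n] → [m] are monotone functions Fin n → Fin m

Monotone : ∀ {n m} → (Fin n → Fin m) → Set
Monotone σ = ∀ {a b} → a ≤ b → σ a ≤ σ b

-- f♭ : [m+1] → [n+1],  f♭(i) = min ({ j ∈ [n] | f j ≥ i } ∪ {n})
-- (computed by scanning j = 0, 1, … , n-1)
flat : ∀ {n m} → (Fin n → Fin m) → Fin (suc m) → Fin (suc n)
flat {zero}  f i = zero
flat {suc n} f i with toℕ i ℕ.≤? toℕ (f zero)
... | yes _ = zero
... | no  _ = suc (flat (λ j → f (suc j)) i)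

face : ∀ {n} → Fin (suc n) → Fin n → Fin (suc n)
face i = punchIn i

module _ {o ℓ e} (C : Category o ℓ e) where
  open Category C

  IsIso : ∀ {X Y} → Hom X Y → Set (ℓ ⊔ e)
  IsIso {X} {Y} φ = Σ (Hom Y X) λ ψ → (ψ ∘ φ ≈ id) × (φ ∘ ψ ≈ id)

  IsPullback : ∀ {P X Y Z} → Hom X Z → Hom Y Z → Hom P X → Hom P Y →
               Set (o ⊔ ℓ ⊔ e)
  IsPullback {P} {X} {Y} {Z} g₁ g₂ p₁ p₂ =
    (g₁ ∘ p₁ ≈ g₂ ∘ p₂) ×
    (∀ {Q} (q₁ : Hom Q X) (q₂ : Hom Q Y) → g₁ ∘ q₁ ≈ g₂ ∘ q₂ →
      Σ (Hom Q P) λ t → ((p₁ ∘ t ≈ q₁) × (p₂ ∘ t ≈ q₂)) ×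
        (∀ (t' : Hom Q P) → p₁ ∘ t' ≈ q₁ → p₂ ∘ t' ≈ q₂ → t ≈ t'))

  DomEq : ∀ {k} {F : Fin k → Obj} {T : Obj} {a b : Fin k} →
          Hom (F a) T → Hom (F b) T → Set e
  DomEq {F = F} {T} {a} {b} φ ψ =
    Σ (a ≡ b) λ eq → subst (λ c → Hom (F c) T) eq φ ≈ ψ

  IxEq : ∀ {k l} {F : Fin k → Obj} {G : Fin l → Obj} {a a' : Fin k} {b b' : Fin l} →
         Hom (F a) (G b) → Hom (F a') (G b') → Set e
  IxEq {F = F} {G} {a} {a'} {b} {b'} φ ψ =
    Σ (a ≡ a') λ eq₁ → Σ (b ≡ b') λ eq₂ →
      subst₂ (λ x y → Hom (F x) (G y)) eq₁ eq₂ φ ≈ ψ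

  record Zigzag (n : ℕ) : Set (o ⊔ ℓ) where
    field
      R   : Fin (suc n) → Obj
      S   : Fin n → Obj
      fwd : (j : Fin n) → Hom (R (inject₁ j)) (S j)
      bwd : (j : Fin n) → Hom (R (suc j)) (S j)

  open Zigzag

  -- zigzag maps X → Y with singular map σ (regular map flat σ)
  record ZMap {n m} (X : Zigzag n) (Y : Zigzag m) (σ : Fin n → Fin m) : Set (ℓ ⊔ e) where
    field
      mono : Monotone σ
      rs   : (i : Fin (suc m)) → Hom (R X (flat σ i)) (R Y i)
      ss   : (j : Fin n) → Hom (S X j) (S Y (σ j))
      first : ∀ j → (∀ j' → j' < j → σ j' ≢ σ j) →
              DomEq {F = R X} (ss j ∘ fwd X j) (fwd Y (σ j) ∘ rs (inject₁ (σ j)))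
      last  : ∀ j → (∀ j' → j < j' → σ j' ≢ σ j) →
              DomEq {F = R X} (ss j ∘ bwd X j) (bwd Y (σ j) ∘ rs (suc (σ j)))
      mid   : ∀ j k → toℕ k ≡ suc (toℕ j) → σ j ≡ σ k →
              IxEq {F = R X} {G = S Y} (ss j ∘ bwd X j) (ss k ∘ fwd X k)
      empty : ∀ i → (∀ j → σ j ≢ i) →
              DomEq {F = R X} (fwd Y i ∘ rs (inject₁ i)) (bwd Y i ∘ rs (suc i))

  open ZMap

  ZMapEq : ∀ {n m} {X : Zigzag n} {Y : Zigzag m} {σ} → ZMap X Y σ → ZMap X Y σ → Set e
  ZMapEq f g = (∀ i → rs f i ≈ rs g i) × (∀ j → ss f j ≈ ss g j)

  CompEq : ∀ {n m l} {X : Zigzag n} {Y : Zigzag m} {Z : Zigzag l}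
             {σ : Fin n → Fin m} {τ : Fin m → Fin l} →
           ZMap Y Z τ → ZMap X Y σ → ZMap X Z (λ j → τ (σ j)) → Set e
  CompEq {X = X} {σ = σ} g f h =
    (∀ j → ss g (σ j) ∘ ss f j ≈ ss h j) ×
    (∀ i → DomEq {F = R X} (rs g i ∘ rs f (flat _ i)) (rs h i))

  IsCartesian : ∀ {n m} {X : Zigzag n} {Y : Zigzag m} {σ : Fin n → Fin m} →
                ZMap X Y σ → Set (o ⊔ ℓ ⊔ e)
  IsCartesian {n} {X = X} {Y} {σ} f =
    ∀ {n'} (X' : Zigzag n') (u : Fin n' → Fin n) → Monotone u →
    (h : ZMap X' Y (λ j → σ (u j))) →
    Σ (ZMap X' X u) λ v → CompEq f v h ×
      (∀ (v' : ZMap X' X u) → CompEq f v' h → ZMapEq v v')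

{-# OPTIONS --safe #-}
module Submission where

-- A map of zigzags over dᵢ is cartesian exactly when its singular slices are invertible and, for
-- every regular index m of A, the regular slices f(r_k) with f♭(k) = m form a limit cone over the
-- part of B lying over m.  Since dᵢ♭ is pinch i, that part is the single object B(r_k) when m ≠ i,
-- where the limit condition says that f(r_k) is invertible, and the cospan
-- B(r_i) → B(s_i) ← B(r_{i+1}) when m = i, where it says that the square is a pullback.
-- Cartesianness is tested on a cone over the fibre at m with vertex Q by replacing A(r_m) with Q;
-- conversely, lifts are built slice by slice from the fibre limits and the inverses of the
-- singular slices.

open import Defs
open import Level using (_⊔_)
open import Data.Nat as ℕ using (ℕ; zero; suc; z≤n; s≤s)
import Data.Nat.Properties as ℕ
open import Data.Fin using (Fin; zero; suc; toℕ; inject₁; punchIn; pinch; fromℕ<; _≤_; _<_)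
open import Data.Fin.Properties
  using ( _≟_; suc-injective; toℕ-fromℕ<; toℕ<n; punchIn-injective; punchInᵢ≢i; punchIn-mono-≤
        ; punchIn-punchOut; pinch-injective; pinch-surjective)
open import Data.Product using (Σ; ∃; _×_; _,_; proj₁; proj₂)
open import Data.Sum using (_⊎_; inj₁; inj₂; map)
open import Function using (_∘′_)
open import Function.Bundles using (_⇔_; mk⇔; Equivalence)
open import Axiom.UniquenessOfIdentityProofs using (module Decidable⇒UIP)
open import Relation.Nullary using (Dec; yes; no; ¬_; contradiction)
open import Relation.Binary using (IsEquivalence)
open import Relation.Binary.PropositionalEquality


-- The regular map of a monotone map, and of a face map

j<flat⇒σj<k : ∀ {n m} (σ : Fin n → Fin m) k j → j < flat σ k → σ j < k
j<flat⇒σj<k {suc n} σ k j j<flat with toℕ k ℕ.≤? toℕ (σ zero)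
j<flat⇒σj<k {suc n} σ k zero    j<flat       | no k≰σ0 = ℕ.≰⇒> k≰σ0
j<flat⇒σj<k {suc n} σ k (suc j) (s≤s j<flat) | no _    = j<flat⇒σj<k (σ ∘′ suc) k j j<flat

j≡flat⇒k≤σj : ∀ {n m} (σ : Fin n → Fin m) k j → toℕ j ≡ toℕ (flat σ k) → k ≤ σ j
j≡flat⇒k≤σj {suc n} σ k j j≡flat with toℕ k ℕ.≤? toℕ (σ zero)
j≡flat⇒k≤σj {suc n} σ k zero    j≡flat | yes k≤σ0 = k≤σ0
j≡flat⇒k≤σj {suc n} σ k (suc j) j≡flat | no _     = j≡flat⇒k≤σj (σ ∘′ suc) k j (ℕ.suc-injective j≡flat)

flat-unique : ∀ {n m} (σ : Fin n → Fin m) k j →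
              (∀ j' → j' < j → σ j' < k) → (∀ j' → toℕ j' ≡ toℕ j → k ≤ σ j') → flat σ k ≡ j
flat-unique {zero}  σ k zero below at = refl
flat-unique {suc n} σ k j below at with toℕ k ℕ.≤? toℕ (σ zero)
flat-unique {suc n} σ k zero    below at | yes _    = refl
flat-unique {suc n} σ k (suc j) below at | yes k≤σ0 = contradiction k≤σ0 (ℕ.<⇒≱ (below zero (s≤s z≤n)))
flat-unique {suc n} σ k zero    below at | no k≰σ0  = contradiction (at zero refl) k≰σ0
flat-unique {suc n} σ k (suc j) below at | no _     =
  cong suc (flat-unique (σ ∘′ suc) k j (λ j' → below (suc j') ∘′ s≤s) (λ j' → at (suc j') ∘′ cong suc))

flat-id : ∀ {n} (k : Fin (suc n)) → flat (λ j → j) k ≡ k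
flat-id k = flat-unique _ k k (λ _ j'<k → j'<k) (λ _ j'≡k → ℕ.≤-reflexive (sym j'≡k))

flat≤j⇒k≤σj : ∀ {n m} (σ : Fin n → Fin m) → Monotone σ → ∀ k j → flat σ k ≤ j → k ≤ σ j
flat≤j⇒k≤σj {n} σ mono k j flat≤j = ℕ.≤-trans (j≡flat⇒k≤σj σ k j₀ (toℕ-fromℕ< flat<n)) (mono j₀≤j)
  where
  flat<n : toℕ (flat σ k) ℕ.< n
  flat<n = ℕ.≤-<-trans flat≤j (toℕ<n j)
  j₀ : Fin n
  j₀ = fromℕ< flat<n
  j₀≤j : j₀ ≤ j
  j₀≤j = subst (ℕ._≤ toℕ j) (sym (toℕ-fromℕ< flat<n)) flat≤j

flat-∘ : ∀ {n m l} (σ : Fin n → Fin m) (τ : Fin m → Fin l) → Monotone τ →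
         ∀ k → flat (τ ∘′ σ) k ≡ flat σ (flat τ k)
flat-∘ σ τ mono k = flat-unique (τ ∘′ σ) k (flat σ (flat τ k))
  (λ j j< → j<flat⇒σj<k τ k (σ j) (j<flat⇒σj<k σ (flat τ k) j j<))
  (λ j j≡ → flat≤j⇒k≤σj τ mono k (σ j) (j≡flat⇒k≤σj σ (flat τ k) j j≡))

flat-face : ∀ {n} (i : Fin (suc n)) k → flat (face i) k ≡ pinch i k
flat-face i k = flat-unique (face i) k (pinch i k) (below i k) (at i k)
  where
  below : ∀ {n} (i : Fin (suc n)) k j → j < pinch i k → punchIn i j < k
  below zero    (suc k) j       j<k       = s≤s j<k
  below (suc i) (suc k) zero    _         = s≤s z≤n
  below (suc i) (suc k) (suc j) (s≤s j<) = s≤s (below i k j j<)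
  at : ∀ {n} (i : Fin (suc n)) k j → toℕ j ≡ toℕ (pinch i k) → k ≤ punchIn i j
  at i       zero    j       _  = z≤n
  at zero    (suc k) j       j≡ = s≤s (ℕ.≤-reflexive (sym j≡))
  at (suc i) (suc k) (suc j) j≡ = s≤s (at i k j (ℕ.suc-injective j≡))

pinch-inject₁-self : ∀ {n} (i : Fin (suc n)) → pinch i (inject₁ i) ≡ i
pinch-inject₁-self         zero    = refl
pinch-inject₁-self {suc n} (suc i) = cong suc (pinch-inject₁-self i)

pinch-suc-self : ∀ {n} (i : Fin (suc n)) → pinch i (suc i) ≡ i
pinch-suc-self         zero    = refl
pinch-suc-self {suc n} (suc i) = cong suc (pinch-suc-self i)

pinch-inject₁-punchIn : ∀ {n} (i : Fin (suc n)) j → pinch i (inject₁ (punchIn i j)) ≡ inject₁ j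
pinch-inject₁-punchIn         zero    j       = refl
pinch-inject₁-punchIn         (suc i) zero    = refl
pinch-inject₁-punchIn {suc n} (suc i) (suc j) = cong suc (pinch-inject₁-punchIn i j)

pinch-suc-punchIn : ∀ {n} (i : Fin (suc n)) j → pinch i (suc (punchIn i j)) ≡ suc j
pinch-suc-punchIn         zero    j       = refl
pinch-suc-punchIn         (suc i) zero    = refl
pinch-suc-punchIn {suc n} (suc i) (suc j) = cong suc (pinch-suc-punchIn i j)

pinch⁻¹-self : ∀ {n} (i : Fin (suc n)) k → pinch i k ≡ i → k ≡ inject₁ i ⊎ k ≡ suc i
pinch⁻¹-self         zero    zero       _  = inj₁ refl
pinch⁻¹-self         zero    (suc zero) _  = inj₂ refl
pinch⁻¹-self {suc n} (suc i) (suc k)    eq =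
  map (cong suc) (cong suc) (pinch⁻¹-self i k (suc-injective eq))

inject₁≢suc : ∀ {n} (i : Fin n) → inject₁ i ≢ suc i
inject₁≢suc zero    ()
inject₁≢suc (suc i) eq = inject₁≢suc i (suc-injective eq)

consecutive-distinct : ∀ {n} {j k : Fin n} → toℕ k ≡ suc (toℕ j) → j ≢ k
consecutive-distinct k≡1+j refl = ℕ.1+n≢n (sym k≡1+j)

module _ {n} (i : Fin (suc n)) where

  flat-face-inject₁-face : ∀ j → flat (face i) (inject₁ (face i j)) ≡ inject₁ j
  flat-face-inject₁-face j = trans (flat-face i _) (pinch-inject₁-punchIn i j)

  flat-face-suc-face : ∀ j → flat (face i) (suc (face i j)) ≡ suc j
  flat-face-suc-face j = trans (flat-face i _) (pinch-suc-punchIn i j)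

  flat-face-suc-self : flat (face i) (suc i) ≡ i
  flat-face-suc-self = trans (flat-face i _) (pinch-suc-self i)

  flat-face-inject₁≡suc : flat (face i) (inject₁ i) ≡ flat (face i) (suc i)
  flat-face-inject₁≡suc = trans (flat-face i _) (trans (pinch-inject₁-self i) (sym flat-face-suc-self))

  flat-face⁻¹-self : ∀ k → flat (face i) k ≡ flat (face i) (suc i) → k ≡ inject₁ i ⊎ k ≡ suc i
  flat-face⁻¹-self k eq = pinch⁻¹-self i k (trans (sym (flat-face i k)) (trans eq flat-face-suc-self))

  flat-face-injective-off : ∀ {k} → k ≢ inject₁ i → k ≢ suc i →
                            ∀ k' → flat (face i) k' ≡ flat (face i) k → k' ≡ k
  flat-face-injective-off {k} k≢i k≢1+i k' eq = pinch-injective 1+i≢k' (k≢1+i ∘′ sym) pinch-eq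
    where
    pinch-eq : pinch i k' ≡ pinch i k
    pinch-eq = trans (sym (flat-face i k')) (trans eq (flat-face i k))
    1+i≢k' : suc i ≢ k'
    1+i≢k' refl with flat-face⁻¹-self k (sym eq)
    ... | inj₁ k≡i   = k≢i k≡i
    ... | inj₂ k≡1+i = k≢1+i k≡1+i

  face-omits-only : ∀ l → (∀ j → face i j ≢ l) → l ≡ i
  face-omits-only l l∉im with i ≟ l
  ... | yes i≡l = sym i≡l
  ... | no  i≢l = contradiction (punchIn-punchOut i≢l) (l∉im _)

  flat-face-hits-off : ∀ m → m ≢ flat (face i) (suc i) →
                       ∃ λ k → flat (face i) k ≡ m × k ≢ inject₁ i × k ≢ suc i
  flat-face-hits-off m m≢ with pinch-surjective i m
  ... | k , pinch≡ = k , hits , (λ { refl → m≢ (trans (sym hits) flat-face-inject₁≡suc) })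
                              , (λ { refl → m≢ (sym hits) })
    where
    hits : flat (face i) k ≡ m
    hits = trans (flat-face i k) (pinch≡ refl)

-- Equality of morphisms whose endpoints are only propositionally equal (≅ is not isomorphism)

module HomEq {o ℓ e} (C : Category o ℓ e) where
  open Category C
  private module ≈ {X Y} = IsEquivalence (≈-equiv {X} {Y})

  infix 4 _≅_
  _≅_ : ∀ {X Y X' Y'} → Hom X Y → Hom X' Y' → Set (o ⊔ e)
  _≅_ {X} {Y} {X'} {Y'} φ ψ = Σ (X ≡ X') λ p → Σ (Y ≡ Y') λ q → subst₂ Hom p q φ ≈ ψ

  ≈⇒≅ : ∀ {X Y} {φ ψ : Hom X Y} → φ ≈ ψ → φ ≅ ψ
  ≈⇒≅ φ≈ψ = refl , refl , φ≈ψ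

  ≅⇒≈ : ∀ {X Y} {φ ψ : Hom X Y} → φ ≅ ψ → φ ≈ ψ
  ≅⇒≈ (refl , refl , φ≈ψ) = φ≈ψ

  ≅-refl : ∀ {X Y} {φ : Hom X Y} → φ ≅ φ
  ≅-refl = ≈⇒≅ ≈.refl

  ≅-sym : ∀ {X Y X' Y'} {φ : Hom X Y} {ψ : Hom X' Y'} → φ ≅ ψ → ψ ≅ φ
  ≅-sym (refl , refl , φ≈ψ) = ≈⇒≅ (≈.sym φ≈ψ)

  ≅-trans : ∀ {X Y X' Y' X'' Y''} {φ : Hom X Y} {ψ : Hom X' Y'} {χ : Hom X'' Y''} →
            φ ≅ ψ → ψ ≅ χ → φ ≅ χ
  ≅-trans (refl , refl , φ≈ψ) (refl , refl , ψ≈χ) = ≈⇒≅ (≈.trans φ≈ψ ψ≈χ)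

  ∘-resp-≅ : ∀ {X Y Z X' Y' Z'} {φ : Hom Y Z} {ψ : Hom X Y} {φ' : Hom Y' Z'} {ψ' : Hom X' Y'} →
             φ ≅ φ' → ψ ≅ ψ' → (φ ∘ ψ) ≅ (φ' ∘ ψ')
  ∘-resp-≅ (refl , refl , φ≈φ') (refl , refl , ψ≈ψ') = ≈⇒≅ (∘-resp-≈ φ≈φ' ψ≈ψ')

  ≅-cong : ∀ {a} {I : Set a} (F G : I → Obj) (φ : ∀ x → Hom (F x) (G x)) {x y} → x ≡ y → φ x ≅ φ y
  ≅-cong F G φ refl = ≅-refl

  subst-≅ : ∀ {a} {I : Set a} (F G : I → Obj) {x y} (eq : x ≡ y) (φ : Hom (F x) (G x)) →
            subst (λ z → Hom (F z) (G z)) eq φ ≅ φ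
  subst-≅ F G refl φ = ≅-refl

  DomEq⇒≅ : ∀ {k} {F : Fin k → Obj} {T a b} {φ : Hom (F a) T} {ψ : Hom (F b) T} →
            DomEq C {F = F} φ ψ → φ ≅ ψ
  DomEq⇒≅ (refl , φ≈ψ) = ≈⇒≅ φ≈ψ

  ≅⇒DomEq : ∀ {k} {F : Fin k → Obj} {T a b} {φ : Hom (F a) T} {ψ : Hom (F b) T} →
            a ≡ b → φ ≅ ψ → DomEq C {F = F} φ ψ
  ≅⇒DomEq refl φ≅ψ = refl , ≅⇒≈ φ≅ψ

  IxEq⇒≅ : ∀ {k l} {F : Fin k → Obj} {G : Fin l → Obj} {a a' b b'}
           {φ : Hom (F a) (G b)} {ψ : Hom (F a') (G b')} → IxEq C {F = F} {G = G} φ ψ → φ ≅ ψ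
  IxEq⇒≅ (refl , refl , φ≈ψ) = ≈⇒≅ φ≈ψ

  ≅⇒IxEq : ∀ {k l} {F : Fin k → Obj} {G : Fin l → Obj} {a a' b b'}
           {φ : Hom (F a) (G b)} {ψ : Hom (F a') (G b')} → a ≡ a' → b ≡ b' → φ ≅ ψ →
           IxEq C {F = F} {G = G} φ ψ
  ≅⇒IxEq refl refl φ≅ψ = refl , refl , ≅⇒≈ φ≅ψ

  module ≅-Reasoning where
    infix  1 begin_
    infixr 2 _≅⟨_⟩_ _≈⟨_⟩_
    infix  3 _∎

    begin_ : ∀ {X Y X' Y'} {φ : Hom X Y} {ψ : Hom X' Y'} → φ ≅ ψ → φ ≅ ψ
    begin φ≅ψ = φ≅ψ

    _≅⟨_⟩_ : ∀ {X Y X' Y' X'' Y''} (φ : Hom X Y) {ψ : Hom X' Y'} {χ : Hom X'' Y''} →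
             φ ≅ ψ → ψ ≅ χ → φ ≅ χ
    φ ≅⟨ φ≅ψ ⟩ ψ≅χ = ≅-trans φ≅ψ ψ≅χ

    _≈⟨_⟩_ : ∀ {X Y X'' Y''} (φ : Hom X Y) {ψ : Hom X Y} {χ : Hom X'' Y''} →
             φ ≈ ψ → ψ ≅ χ → φ ≅ χ
    φ ≈⟨ φ≈ψ ⟩ ψ≅χ = ≅-trans (≈⇒≅ φ≈ψ) ψ≅χ

    _∎ : ∀ {X Y} (φ : Hom X Y) → φ ≅ φ
    φ ∎ = ≅-refl

  iso-cancelˡ : ∀ {W X Y} {φ : Hom X Y} (φ-iso : IsIso C φ) (ψ : Hom W Y) → φ ∘ (proj₁ φ-iso ∘ ψ) ≈ ψ
  iso-cancelˡ (_ , _ , φ∘φ⁻¹≈id) ψ = ≈.trans (≈.sym assoc) (≈.trans (∘-resp-≈ φ∘φ⁻¹≈id ≈.refl) identityˡ)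

  iso-monic : ∀ {W X Y} {φ : Hom X Y} → IsIso C φ → {ψ χ : Hom W X} → φ ∘ ψ ≈ φ ∘ χ → ψ ≈ χ
  iso-monic {φ = φ} (φ⁻¹ , φ⁻¹∘φ≈id , _) {ψ} {χ} φψ≈φχ =
    ≈.trans (cancel ψ) (≈.trans (∘-resp-≈ ≈.refl φψ≈φχ) (≈.sym (cancel χ)))
    where
    cancel : ∀ ρ → ρ ≈ φ⁻¹ ∘ (φ ∘ ρ)
    cancel ρ = ≈.sym (≈.trans (≈.sym assoc) (≈.trans (∘-resp-≈ φ⁻¹∘φ≈id ≈.refl) identityˡ))

  iso-monic-≅ : ∀ {W W' X Y X' Y'} {φ : Hom X Y} {φ' : Hom X' Y'} {ψ : Hom W X} {χ : Hom W' X'} →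
                IsIso C φ → φ ≅ φ' → (φ ∘ ψ) ≅ (φ' ∘ χ) → ψ ≅ χ
  iso-monic-≅ φ-iso (refl , refl , φ≈φ') (refl , refl , φψ≈φ'χ) =
    ≈⇒≅ (iso-monic φ-iso (≈.trans φψ≈φ'χ (∘-resp-≈ (≈.sym φ≈φ') ≈.refl)))

module Update {o ℓ e} (C : Category o ℓ e) {k} (F : Fin k → Category.Obj C) (m₀ : Fin k)
              (Q : Category.Obj C) where
  open Category C
  open HomEq C
  open Decidable⇒UIP (_≟_ {k}) using (≡-irrelevant)

  updated : ∀ x → Dec (x ≡ m₀) → Obj
  updated x (yes _) = Q
  updated x (no _)  = F x

  pick : ∀ {T} x (d : Dec (x ≡ m₀)) → (x ≡ m₀ → Hom Q T) → Hom (F x) T → Hom (updated x d) T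
  pick x (yes p) g _ = g p
  pick x (no _)  _ h = h

  pick-yes : ∀ {T} x d (g : x ≡ m₀ → Hom Q T) h p → pick x d g h ≅ g p
  pick-yes x (yes p') g h p rewrite ≡-irrelevant p' p = ≅-refl
  pick-yes x (no ¬p)  g h p = contradiction p ¬p

  pick-no : ∀ {T} x d (g : x ≡ m₀ → Hom Q T) h → ¬ x ≡ m₀ → pick x d g h ≅ h
  pick-no x (yes p) g h ¬p = contradiction p ¬p
  pick-no x (no _)  g h ¬p = ≅-refl

  updated-at : ∀ d → updated m₀ d ≡ Q
  updated-at (yes _) = refl
  updated-at (no ¬p) = contradiction refl ¬p

-- Zigzag maps over the identity

module Zigzags {o ℓ e} (C : Category o ℓ e) where
  open Category C
  open HomEq C
  open Zigzag
  open ZMap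
  private module ≈ {X Y} = IsEquivalence (≈-equiv {X} {Y})

  reindex-flat-id : ∀ {n} (X Y : Zigzag C n) → (∀ x → Hom (R X x) (R Y x)) →
                    ∀ x → Hom (R X (flat (λ j → j) x)) (R Y x)
  reindex-flat-id X Y ρ x = subst (λ c → Hom (R X c) (R Y x)) (sym (flat-id x)) (ρ x)

  reindex-flat-id-≅ : ∀ {n} (X Y : Zigzag C n) (ρ : ∀ x → Hom (R X x) (R Y x)) x →
                      reindex-flat-id X Y ρ x ≅ ρ x
  reindex-flat-id-≅ X Y ρ x = subst-≅ (R X) (λ _ → R Y x) (sym (flat-id x)) (ρ x)

  levelwise : ∀ {n} {X Y : Zigzag C n}
              (ρ : ∀ x → Hom (R X x) (R Y x)) (τ : ∀ j → Hom (S X j) (S Y j)) →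
              (∀ j → τ j ∘ fwd X j ≈ fwd Y j ∘ ρ (inject₁ j)) →
              (∀ j → τ j ∘ bwd X j ≈ bwd Y j ∘ ρ (suc j)) →
              ZMap C X Y (λ j → j)
  levelwise {X = X} {Y} ρ τ fwd-sq bwd-sq = record
    { mono  = λ j≤k → j≤k
    ; rs    = reindex-flat-id X Y ρ
    ; ss    = τ
    ; first = λ j _ → ≅⇒DomEq (sym (flat-id _)) (square (fwd-sq j))
    ; last  = λ j _ → ≅⇒DomEq (sym (flat-id _)) (square (bwd-sq j))
    ; mid   = λ j k k≡1+j j≡k → contradiction j≡k (consecutive-distinct k≡1+j)
    ; empty = λ x x∉ → contradiction refl (x∉ x)
    }
    where
    square : ∀ {x T} {a : Hom (R X x) T} {b : Hom (R Y x) T} →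
             a ≈ b ∘ ρ x → a ≅ (b ∘ reindex-flat-id X Y ρ x)
    square {x} sq = ≅-trans (≈⇒≅ sq) (∘-resp-≅ ≅-refl (≅-sym (reindex-flat-id-≅ X Y ρ x)))

  id-ZMap : ∀ {n} (X : Zigzag C n) → ZMap C X X (λ j → j)
  id-ZMap X = levelwise (λ _ → id) (λ _ → id) (λ _ → id-comm) (λ _ → id-comm)
    where
    id-comm : ∀ {V W} {φ : Hom V W} → id ∘ φ ≈ φ ∘ id
    id-comm = ≈.trans identityˡ (≈.sym identityʳ)

  CompEq-identityʳ : ∀ {n m} {X : Zigzag C n} {Y : Zigzag C m} {σ} (g : ZMap C X Y σ) →
                     CompEq C g (id-ZMap X) g
  CompEq-identityʳ {X = X} g =
    (λ _ → identityʳ) ,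
    (λ k → ≅⇒DomEq (flat-id _)
             (≅-trans (∘-resp-≅ ≅-refl (reindex-flat-id-≅ X X (λ _ → id) _)) (≈⇒≅ identityʳ)))

  first-over-id : ∀ {n} {X Y : Zigzag C n} (v : ZMap C X Y (λ j → j)) j →
                  (ss v j ∘ fwd X j) ≅ (fwd Y j ∘ rs v (inject₁ j))
  first-over-id v j = DomEq⇒≅ (first v j (λ j' j'<j j'≡j → ℕ.<-irrefl (cong toℕ j'≡j) j'<j))

  last-over-id : ∀ {n} {X Y : Zigzag C n} (v : ZMap C X Y (λ j → j)) j →
                 (ss v j ∘ bwd X j) ≅ (bwd Y j ∘ rs v (suc j))
  last-over-id v j = DomEq⇒≅ (last v j (λ j' j<j' j'≡j → ℕ.<-irrefl (cong toℕ (sym j'≡j)) j<j'))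

  cartesian-lifts-unique : ∀ {n m} {X : Zigzag C n} {Y : Zigzag C m} {σ} {f : ZMap C X Y σ} →
    IsCartesian C f → ∀ {n'} {X' : Zigzag C n'} {u : Fin n' → Fin n} → Monotone u →
    {h : ZMap C X' Y (λ j → σ (u j))} (v v' : ZMap C X' X u) →
    CompEq C f v h → CompEq C f v' h → ZMapEq C v v'
  cartesian-lifts-unique cart {X' = X'} {u} u-mono {h} v v' v-lifts v'-lifts
    with cart X' u u-mono h
  ... | _ , _ , unique with unique v v-lifts | unique v' v'-lifts
  ...   | rs≈ , ss≈ | rs≈' , ss≈' =
    (λ x → ≈.trans (≈.sym (rs≈ x)) (rs≈' x)) , (λ j → ≈.trans (≈.sym (ss≈ j)) (ss≈' j))

-- Zigzag maps over a face map

module FaceMap {o ℓ e} (C : Category o ℓ e) {n} (i : Fin (suc n))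
               {A : Zigzag C n} {B : Zigzag C (suc n)} (f : ZMap C A B (face i)) where
  open Category C
  open HomEq C
  open Zigzags C
  open Zigzag
  open ZMap
  open Decidable⇒UIP (_≟_ {suc n}) using (≡-irrelevant)
  private module ≈ {X Y} = IsEquivalence (≈-equiv {X} {Y})

  ♭ : Fin (suc (suc n)) → Fin (suc n)
  ♭ = flat (face i)

  slice : ∀ {m} k → ♭ k ≡ m → Hom (R A m) (R B k)
  slice k p = subst (λ c → Hom (R A c) (R B k)) p (rs f k)

  slice-≅ : ∀ {m} k (p : ♭ k ≡ m) → slice k p ≅ rs f k
  slice-≅ k p = subst-≅ (R A) (λ _ → R B k) p (rs f k)

  fwd-square : ∀ j → ss f j ∘ fwd A j ≈ fwd B (face i j) ∘ slice _ (flat-face-inject₁-face i j)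
  fwd-square j = ≅⇒≈ (≅-trans (DomEq⇒≅ (first f j λ j' j'<j eq →
                   ℕ.<-irrefl (cong toℕ (punchIn-injective i j' j eq)) j'<j))
                 (∘-resp-≅ ≅-refl (≅-sym (slice-≅ _ _))))

  bwd-square : ∀ j → ss f j ∘ bwd A j ≈ bwd B (face i j) ∘ slice _ (flat-face-suc-face i j)
  bwd-square j = ≅⇒≈ (≅-trans (DomEq⇒≅ (last f j λ j' j<j' eq →
                   ℕ.<-irrefl (cong toℕ (punchIn-injective i j j' (sym eq))) j<j'))
                 (∘-resp-≅ ≅-refl (≅-sym (slice-≅ _ _))))

  gap-square : (fwd B i ∘ rs f (inject₁ i)) ≅ (bwd B i ∘ rs f (suc i))
  gap-square = DomEq⇒≅ (empty f i (punchInᵢ≢i i))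

  -- The part of B over m consists of the B(r_k) with ♭ k ≡ m; the only cospan of B that can lie
  -- inside it is the one at i, the singular index that dᵢ misses.
  record FibreCone (m : Fin (suc n)) (Q : Obj) : Set (ℓ ⊔ e) where
    field
      leg          : ∀ k → ♭ k ≡ m → Hom Q (R B k)
      leg-commutes : ∀ p p' → fwd B i ∘ leg (inject₁ i) p ≈ bwd B i ∘ leg (suc i) p'
  open FibreCone

  Factors : ∀ {m Q} → Hom Q (R A m) → FibreCone m Q → Set e
  Factors t c = ∀ k p → slice k p ∘ t ≈ leg c k p

  IsFibreLimit : Fin (suc n) → Set (o ⊔ ℓ ⊔ e)
  IsFibreLimit m = ∀ {Q} (c : FibreCone m Q) →
                   Σ (Hom Q (R A m)) λ t → Factors t c × (∀ t' → Factors t' c → t ≈ t')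

  fibreLimit-unique : ∀ {m Q} → IsFibreLimit m → (c : FibreCone m Q) →
                      ∀ {t t'} → Factors t c → Factors t' c → t ≈ t'
  fibreLimit-unique lim c t-factors t'-factors with lim c
  ... | _ , _ , unique = ≈.trans (≈.sym (unique _ t-factors)) (unique _ t'-factors)

  slice-cone : ∀ m → FibreCone m (R A m)
  slice-cone m = record
    { leg          = slice
    ; leg-commutes = λ p p' → ≅⇒≈ (begin
        fwd B i ∘ slice (inject₁ i) p ≅⟨ ∘-resp-≅ ≅-refl (slice-≅ _ p) ⟩
        fwd B i ∘ rs f (inject₁ i)    ≅⟨ gap-square ⟩
        bwd B i ∘ rs f (suc i)        ≅⟨ ∘-resp-≅ ≅-refl (≅-sym (slice-≅ _ p')) ⟩
        bwd B i ∘ slice (suc i) p'    ∎)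
    }
    where open ≅-Reasoning

  id-factors-slice-cone : ∀ m → Factors id (slice-cone m)
  id-factors-slice-cone m k p = identityʳ

  SingletonFibre : Fin (suc (suc n)) → Set
  SingletonFibre k = ∀ k' → ♭ k' ≡ ♭ k → k' ≡ k

  module _ {k} (singleton : SingletonFibre k) where

    iso⇒fibreLimit : IsIso C (rs f k) → IsFibreLimit (♭ k)
    iso⇒fibreLimit rs-iso@(rs⁻¹ , _) c = rs⁻¹ ∘ leg c k refl , factors , unique
      where
      factors : Factors (rs⁻¹ ∘ leg c k refl) c
      factors k' p with singleton k' p
      ... | refl rewrite ≡-irrelevant p refl = iso-cancelˡ rs-iso (leg c k refl)
      unique : ∀ t' → Factors t' c → rs⁻¹ ∘ leg c k refl ≈ t'
      unique t' t'-factors =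
        iso-monic rs-iso (≈.trans (iso-cancelˡ rs-iso _) (≈.sym (t'-factors k refl)))

    inverse-cone : FibreCone (♭ k) (R B k)
    inverse-cone = record
      { leg          = λ k' p → subst (λ c → Hom (R B k) (R B c)) (sym (singleton k' p)) id
      ; leg-commutes = λ p p' →
          contradiction (trans (singleton _ p) (sym (singleton _ p'))) (inject₁≢suc i)
      }

    fibreLimit⇒iso : IsFibreLimit (♭ k) → IsIso C (rs f k)
    fibreLimit⇒iso lim with lim inverse-cone
    ... | t , t-factors , _ = t , left-inverse , right-inverse
      where
      right-inverse : rs f k ∘ t ≈ id
      right-inverse = ≈.trans (t-factors k refl)
        (≅⇒≈ (subst-≅ (λ _ → R B k) (R B) (sym (singleton k refl)) id))
      factors : Factors (t ∘ rs f k) (slice-cone (♭ k))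
      factors k' p with singleton k' p
      ... | refl rewrite ≡-irrelevant p refl =
        ≈.trans (≈.sym assoc) (≈.trans (∘-resp-≈ right-inverse ≈.refl) identityˡ)
      left-inverse : t ∘ rs f k ≈ id
      left-inverse = fibreLimit-unique lim (slice-cone (♭ k)) factors (id-factors-slice-cone (♭ k))

  module _ (eq : ♭ (inject₁ i) ≡ ♭ (suc i)) where

    pullback⇒fibreLimit : IsPullback C (fwd B i) (bwd B i) (slice (inject₁ i) eq) (rs f (suc i)) →
                          IsFibreLimit (♭ (suc i))
    pullback⇒fibreLimit (_ , universal) c with universal (leg c (inject₁ i) eq) (leg c (suc i) refl)
                                                         (leg-commutes c eq refl)
    ... | t , (t-factors₁ , t-factors₂) , unique = t , factors , λ t' t'-factors →
      unique t' (t'-factors (inject₁ i) eq) (t'-factors (suc i) refl)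
      where
      factors : Factors t c
      factors k p with flat-face⁻¹-self i k p
      ... | inj₁ refl rewrite ≡-irrelevant p eq   = t-factors₁
      ... | inj₂ refl rewrite ≡-irrelevant p refl = t-factors₂

    module _ {Q} (q₁ : Hom Q (R B (inject₁ i))) (q₂ : Hom Q (R B (suc i)))
             (q-commute : fwd B i ∘ q₁ ≈ bwd B i ∘ q₂) where

      private
        pair-leg : ∀ k → k ≡ inject₁ i ⊎ k ≡ suc i → Hom Q (R B k)
        pair-leg _ (inj₁ refl) = q₁
        pair-leg _ (inj₂ refl) = q₂

        pair-leg₁ : ∀ s → pair-leg (inject₁ i) s ≡ q₁
        pair-leg₁ (inj₁ refl)  = refl
        pair-leg₁ (inj₂ i≡1+i) = contradiction i≡1+i (inject₁≢suc i)

        pair-leg₂ : ∀ s → pair-leg (suc i) s ≡ q₂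
        pair-leg₂ (inj₁ 1+i≡i) = contradiction (sym 1+i≡i) (inject₁≢suc i)
        pair-leg₂ (inj₂ refl)  = refl

      pair-cone : FibreCone (♭ (suc i)) Q
      pair-cone = record
        { leg          = λ k p → pair-leg k (flat-face⁻¹-self i k p)
        ; leg-commutes = λ p p' → subst₂ (λ φ ψ → fwd B i ∘ φ ≈ bwd B i ∘ ψ)
            (sym (pair-leg₁ _)) (sym (pair-leg₂ _)) q-commute
        }

      factors-pair-cone⇔ : ∀ t → Factors t pair-cone ⇔
                           (slice (inject₁ i) eq ∘ t ≈ q₁ × rs f (suc i) ∘ t ≈ q₂)
      factors-pair-cone⇔ t = mk⇔
        (λ t-factors → subst (_ ≈_) (pair-leg₁ _) (t-factors (inject₁ i) eq) ,
                       subst (_ ≈_) (pair-leg₂ _) (t-factors (suc i) refl))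
        (λ (t₁ , t₂) k p → factors t₁ t₂ k p)
        where
        factors : slice (inject₁ i) eq ∘ t ≈ q₁ → rs f (suc i) ∘ t ≈ q₂ → Factors t pair-cone
        factors t₁ t₂ k p with flat-face⁻¹-self i k p
        ... | inj₁ refl rewrite ≡-irrelevant p eq   = t₁
        ... | inj₂ refl rewrite ≡-irrelevant p refl = t₂

    fibreLimit⇒pullback : IsFibreLimit (♭ (suc i)) →
                          IsPullback C (fwd B i) (bwd B i) (slice (inject₁ i) eq) (rs f (suc i))
    fibreLimit⇒pullback lim = leg-commutes (slice-cone (♭ (suc i))) eq refl , λ q₁ q₂ q-commute →
      let t , t-factors , unique = lim (pair-cone q₁ q₂ q-commute)
          factors⇔ = factors-pair-cone⇔ q₁ q₂ q-commute
      in t , Equivalence.to (factors⇔ t) t-factors ,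
         λ t' t'₁ t'₂ → unique t' (Equivalence.from (factors⇔ t') (t'₁ , t'₂))

  fibreLimits : (∀ k → k ≢ inject₁ i → k ≢ suc i → IsIso C (rs f k)) →
                ∀ eq → IsPullback C (fwd B i) (bwd B i) (slice (inject₁ i) eq) (rs f (suc i)) →
                ∀ m → IsFibreLimit m
  fibreLimits isos eq pb m with m ≟ ♭ (suc i)
  ... | yes refl = pullback⇒fibreLimit eq pb
  ... | no m≢    with flat-face-hits-off i m m≢
  ...   | k , refl , k≢i , k≢1+i =
    iso⇒fibreLimit (flat-face-injective-off i k≢i k≢1+i) (isos k k≢i k≢1+i)

  -- Lifting f', which is f with its singular slices moved into A', gives a right inverse of each
  -- f(s_j); uniqueness of lifts of f itself along the identity makes it a left inverse.
  cartesian⇒ss-iso : IsCartesian C f → ∀ j → IsIso C (ss f j)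
  cartesian⇒ss-iso cart j = ss v j , left-inverse , proj₁ v-lifts j
    where
    A' : Zigzag C n
    A' = record
      { R = R A ; S = λ j → S B (face i j)
      ; fwd = λ j → ss f j ∘ fwd A j ; bwd = λ j → ss f j ∘ bwd A j }

    f' : ZMap C A' B (face i)
    f' = record
      { mono  = mono f
      ; rs    = rs f
      ; ss    = λ _ → id
      ; first = λ j _ → ≅⇒DomEq (sym (flat-face-inject₁-face i j)) (f'-square (fwd-square j))
      ; last  = λ j _ → ≅⇒DomEq (sym (flat-face-suc-face i j)) (f'-square (bwd-square j))
      ; mid   = λ j k k≡1+j eq → contradiction (punchIn-injective i j k eq) (consecutive-distinct k≡1+j)
      ; empty = empty f
      }
      where
      f'-square : ∀ {j x y} {a : Hom (R A x) (S A j)} {b : Hom (R B y) (S B (face i j))} {e} →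
                  ss f j ∘ a ≈ b ∘ slice y e → (id ∘ (ss f j ∘ a)) ≅ (b ∘ rs f y)
      f'-square {e = e} sq = ≅-trans (≈⇒≅ (≈.trans identityˡ sq)) (∘-resp-≅ ≅-refl (slice-≅ _ e))

    v : ZMap C A' A (λ j → j)
    v = proj₁ (cart A' (λ j → j) (λ j≤k → j≤k) f')

    v-lifts : CompEq C f v f'
    v-lifts = proj₁ (proj₂ (cart A' (λ j → j) (λ j≤k → j≤k) f'))

    reindex : ∀ x → Hom (R A x) (R A x)
    reindex x = subst (λ c → Hom (R A c) (R A x)) (flat-id x) (rs v x)

    reindex-≅ : ∀ x → reindex x ≅ rs v x
    reindex-≅ x = subst-≅ (R A) (λ _ → R A x) (flat-id x) (rs v x)

    w-square : ∀ {x T U V} {a : Hom (R A x) T} {g : Hom T U} {s : Hom U V} {b : Hom (R A x) V} →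
               (s ∘ (g ∘ a)) ≅ (b ∘ rs v x) → (s ∘ g) ∘ a ≈ b ∘ reindex x
    w-square sq = ≅⇒≈ (≅-trans (≈⇒≅ assoc) (≅-trans sq (∘-resp-≅ ≅-refl (≅-sym (reindex-≅ _)))))

    w : ZMap C A A (λ j → j)
    w = levelwise reindex (λ j → ss v j ∘ ss f j)
                  (λ j → w-square (first-over-id v j)) (λ j → w-square (last-over-id v j))

    w-lifts : CompEq C f w f
    w-lifts = (λ j → ≈.trans (≈.sym assoc) (≈.trans (∘-resp-≈ (proj₁ v-lifts j) ≈.refl) identityˡ))
            , (λ k → ≅⇒DomEq (flat-id _) (≅-trans
                 (∘-resp-≅ ≅-refl (≅-trans (reindex-flat-id-≅ A A reindex _) (reindex-≅ _)))
                 (DomEq⇒≅ (proj₂ v-lifts k))))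

    left-inverse : ss v j ∘ ss f j ≈ id
    left-inverse = proj₂ (cartesian-lifts-unique {f = f} cart (λ j≤k → j≤k) {h = f} w (id-ZMap A) w-lifts
                                                 (CompEq-identityʳ f)) j

  -- A cone c over the fibre at m₀ with vertex Q becomes a map h into B from A with A(r_m₀) replaced
  -- by Q, whose new maps into A(s_j) go through c and f(s_j)⁻¹.  The slice at m₀ of the lift of h
  -- along the identity factors c, and any other factorisation t' yields another such lift.
  cartesian⇒fibreLimit : IsCartesian C f → (∀ j → IsIso C (ss f j)) → ∀ m → IsFibreLimit m
  cartesian⇒fibreLimit cart ss-iso m₀ {Q} c = t , t-factors , t-unique
    where
    open Update C (R A) m₀ Q
    open ≅-Reasoning

    R' : Fin (suc n) → Obj
    R' x = updated x (x ≟ m₀)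

    via-cone : ∀ j {x y} → ♭ y ≡ x → Hom (R B y) (S B (face i j)) → x ≡ m₀ → Hom Q (S A j)
    via-cone j {y = y} e b p = proj₁ (ss-iso j) ∘ (b ∘ leg c y (trans e p))

    attaching : ∀ j {x y} → ♭ y ≡ x → Hom (R B y) (S B (face i j)) → Hom (R A x) (S A j) →
                Hom (R' x) (S A j)
    attaching j {x} e b a = pick x (x ≟ m₀) (via-cone j e b) a

    A[m₀≔Q] : Zigzag C n
    A[m₀≔Q] = record
      { R   = R'
      ; S   = S A
      ; fwd = λ j → attaching j (flat-face-inject₁-face i j) (fwd B (face i j)) (fwd A j)
      ; bwd = λ j → attaching j (flat-face-suc-face i j) (bwd B (face i j)) (bwd A j)
      }

    attaching-yes : ∀ j {x y} (e : ♭ y ≡ x) b a (p : x ≡ m₀) → attaching j e b a ≅ via-cone j e b p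
    attaching-yes j {x} e b a = pick-yes x (x ≟ m₀) (via-cone j e b) a

    attaching-no : ∀ j {x y} (e : ♭ y ≡ x) b a → x ≢ m₀ → attaching j e b a ≅ a
    attaching-no j {x} e b a = pick-no x (x ≟ m₀) (via-cone j e b) a

    ρ' : ∀ k → Hom (R' (♭ k)) (R B k)
    ρ' k = pick (♭ k) (♭ k ≟ m₀) (leg c k) (rs f k)

    ρ'-yes : ∀ k (p : ♭ k ≡ m₀) → ρ' k ≅ leg c k p
    ρ'-yes k = pick-yes (♭ k) (♭ k ≟ m₀) (leg c k) (rs f k)

    ρ'-no : ∀ k → ♭ k ≢ m₀ → ρ' k ≅ rs f k
    ρ'-no k = pick-no (♭ k) (♭ k ≟ m₀) (leg c k) (rs f k)

    h-square : ∀ j {x y} (e : ♭ y ≡ x) {b a} → ss f j ∘ a ≈ b ∘ slice y e →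
               (ss f j ∘ attaching j e b a) ≅ (b ∘ ρ' y)
    h-square j {x} {y} e {b} {a} sq = by-cases (x ≟ m₀)
      where
      by-cases : Dec (x ≡ m₀) → (ss f j ∘ attaching j e b a) ≅ (b ∘ ρ' y)
      by-cases (yes p) = begin
        ss f j ∘ attaching j e b a ≅⟨ ∘-resp-≅ ≅-refl (attaching-yes j e b a p) ⟩
        ss f j ∘ via-cone j e b p  ≈⟨ iso-cancelˡ (ss-iso j) _ ⟩
        b ∘ leg c y (trans e p)    ≅⟨ ∘-resp-≅ ≅-refl (≅-sym (ρ'-yes y _)) ⟩
        b ∘ ρ' y                   ∎
      by-cases (no x≢m₀) = begin
        ss f j ∘ attaching j e b a ≅⟨ ∘-resp-≅ ≅-refl (attaching-no j e b a x≢m₀) ⟩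
        ss f j ∘ a                 ≈⟨ sq ⟩
        b ∘ slice y e              ≅⟨ ∘-resp-≅ ≅-refl (slice-≅ y e) ⟩
        b ∘ rs f y                 ≅⟨ ∘-resp-≅ ≅-refl (≅-sym (ρ'-no y (x≢m₀ ∘′ trans (sym e)))) ⟩
        b ∘ ρ' y                   ∎

    h-gap : ∀ l → l ≡ i → DomEq C {F = R'} (fwd B l ∘ ρ' (inject₁ l)) (bwd B l ∘ ρ' (suc l))
    h-gap .i refl = ≅⇒DomEq (flat-face-inject₁≡suc i) (by-cases (♭ (inject₁ i) ≟ m₀))
      where
      by-cases : Dec (♭ (inject₁ i) ≡ m₀) → (fwd B i ∘ ρ' (inject₁ i)) ≅ (bwd B i ∘ ρ' (suc i))
      by-cases (yes p) = begin
        fwd B i ∘ ρ' (inject₁ i)       ≅⟨ ∘-resp-≅ ≅-refl (ρ'-yes _ p) ⟩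
        fwd B i ∘ leg c (inject₁ i) p  ≈⟨ leg-commutes c p p' ⟩
        bwd B i ∘ leg c (suc i) p'     ≅⟨ ∘-resp-≅ ≅-refl (≅-sym (ρ'-yes _ p')) ⟩
        bwd B i ∘ ρ' (suc i)           ∎
        where
        p' : ♭ (suc i) ≡ m₀
        p' = trans (sym (flat-face-inject₁≡suc i)) p
      by-cases (no ♭i≢m₀) = begin
        fwd B i ∘ ρ' (inject₁ i)   ≅⟨ ∘-resp-≅ ≅-refl (ρ'-no _ ♭i≢m₀) ⟩
        fwd B i ∘ rs f (inject₁ i) ≅⟨ gap-square ⟩
        bwd B i ∘ rs f (suc i)     ≅⟨ ∘-resp-≅ ≅-refl (≅-sym (ρ'-no _ ♭1+i≢m₀)) ⟩
        bwd B i ∘ ρ' (suc i)       ∎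
        where
        ♭1+i≢m₀ : ♭ (suc i) ≢ m₀
        ♭1+i≢m₀ = ♭i≢m₀ ∘′ trans (flat-face-inject₁≡suc i)

    h : ZMap C A[m₀≔Q] B (face i)
    h = record
      { mono  = mono f
      ; rs    = ρ'
      ; ss    = ss f
      ; first = λ j _ → ≅⇒DomEq (sym (flat-face-inject₁-face i j)) (h-square j _ (fwd-square j))
      ; last  = λ j _ → ≅⇒DomEq (sym (flat-face-suc-face i j)) (h-square j _ (bwd-square j))
      ; mid   = λ j k k≡1+j eq → contradiction (punchIn-injective i j k eq) (consecutive-distinct k≡1+j)
      ; empty = λ l l∉ → h-gap l (face-omits-only i l l∉)
      }

    v : ZMap C A[m₀≔Q] A (λ x → x)
    v = proj₁ (cart A[m₀≔Q] (λ x → x) (λ x≤y → x≤y) h)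

    v-lifts : CompEq C f v h
    v-lifts = proj₁ (proj₂ (cart A[m₀≔Q] (λ x → x) (λ x≤y → x≤y) h))

    t : Hom Q (R A m₀)
    t = subst (λ X → Hom X (R A m₀)) (trans (cong R' (flat-id m₀)) (updated-at (m₀ ≟ m₀))) (rs v m₀)

    t-≅ : ∀ {x} → x ≡ m₀ → t ≅ rs v x
    t-≅ x≡m₀ = ≅-trans (subst-≅ (λ X → X) (λ _ → R A m₀) _ (rs v m₀))
                       (≅-cong (λ x → R' (flat (λ x → x) x)) (R A) (rs v) (sym x≡m₀))

    t-factors : Factors t c
    t-factors k p = ≅⇒≈ (begin
      slice k p ∘ t        ≅⟨ ∘-resp-≅ (slice-≅ k p) (t-≅ p) ⟩
      rs f k ∘ rs v (♭ k)  ≅⟨ DomEq⇒≅ (proj₂ v-lifts k) ⟩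
      ρ' k                 ≅⟨ ρ'-yes k p ⟩
      leg c k p            ∎)

    t-unique : ∀ t' → Factors t' c → t ≈ t'
    t-unique t' t'-factors = ≅⇒≈ (begin
      t         ≅⟨ t-≅ refl ⟩
      rs v m₀   ≈⟨ proj₁ v≈v' m₀ ⟩
      rs v' m₀  ≅⟨ reindex-flat-id-≅ A[m₀≔Q] A ρ m₀ ⟩
      ρ m₀      ≅⟨ ρ-yes m₀ refl ⟩
      t'        ∎)
      where
      t'-at : ∀ x → x ≡ m₀ → Hom Q (R A x)
      t'-at x p = subst (λ c → Hom Q (R A c)) (sym p) t'

      ρ : ∀ x → Hom (R' x) (R A x)
      ρ x = pick x (x ≟ m₀) (t'-at x) id

      ρ-yes : ∀ x (p : x ≡ m₀) → ρ x ≅ t'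
      ρ-yes x p = ≅-trans (pick-yes x (x ≟ m₀) (t'-at x) id p) (subst-≅ (λ _ → Q) (R A) (sym p) t')

      ρ-no : ∀ x → x ≢ m₀ → ρ x ≅ id {R A x}
      ρ-no x = pick-no x (x ≟ m₀) (t'-at x) id

      v'-square : ∀ j {x y} (e : ♭ y ≡ x) {b a} → ss f j ∘ a ≈ b ∘ slice y e →
                  id ∘ attaching j e b a ≈ a ∘ ρ x
      v'-square j {x} {y} e {b} {a} sq = ≅⇒≈ (≅-trans (≈⇒≅ identityˡ) (by-cases (x ≟ m₀)))
        where
        by-cases : Dec (x ≡ m₀) → attaching j e b a ≅ (a ∘ ρ x)
        by-cases (yes p) = ≅-trans (attaching-yes j e b a p) (iso-monic-≅ (ss-iso j) ≅-refl (begin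
          ss f j ∘ via-cone j e b p       ≈⟨ iso-cancelˡ (ss-iso j) _ ⟩
          b ∘ leg c y (trans e p)         ≈⟨ ∘-resp-≈ ≈.refl (≈.sym (t'-factors y _)) ⟩
          b ∘ (slice y (trans e p) ∘ t')  ≅⟨ ∘-resp-≅ ≅-refl (∘-resp-≅ slices-≅ (≅-sym (ρ-yes x p))) ⟩
          b ∘ (slice y e ∘ ρ x)           ≈⟨ ≈.sym assoc ⟩
          (b ∘ slice y e) ∘ ρ x           ≈⟨ ∘-resp-≈ (≈.sym sq) ≈.refl ⟩
          (ss f j ∘ a) ∘ ρ x              ≈⟨ assoc ⟩
          ss f j ∘ (a ∘ ρ x)              ∎))
          where
          slices-≅ : slice y (trans e p) ≅ slice y e
          slices-≅ = ≅-trans (slice-≅ y _) (≅-sym (slice-≅ y e))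
        by-cases (no x≢m₀) = begin
          attaching j e b a ≅⟨ attaching-no j e b a x≢m₀ ⟩
          a                 ≈⟨ ≈.sym identityʳ ⟩
          a ∘ id            ≅⟨ ∘-resp-≅ ≅-refl (≅-sym (ρ-no x x≢m₀)) ⟩
          a ∘ ρ x           ∎

      v' : ZMap C A[m₀≔Q] A (λ x → x)
      v' = levelwise ρ (λ _ → id) (λ j → v'-square j _ (fwd-square j))
                                   (λ j → v'-square j _ (bwd-square j))

      v'-lifts : CompEq C f v' h
      v'-lifts = (λ _ → identityʳ) , λ k → ≅⇒DomEq (flat-id _) (≅-trans
        (∘-resp-≅ ≅-refl (reindex-flat-id-≅ A[m₀≔Q] A ρ (♭ k))) (by-cases k (♭ k ≟ m₀)))
        where
        by-cases : ∀ k → Dec (♭ k ≡ m₀) → (rs f k ∘ ρ (♭ k)) ≅ ρ' k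
        by-cases k (yes p) = begin
          rs f k ∘ ρ (♭ k) ≅⟨ ∘-resp-≅ (≅-sym (slice-≅ k p)) (ρ-yes _ p) ⟩
          slice k p ∘ t'   ≈⟨ t'-factors k p ⟩
          leg c k p        ≅⟨ ≅-sym (ρ'-yes k p) ⟩
          ρ' k             ∎
        by-cases k (no ♭k≢m₀) = begin
          rs f k ∘ ρ (♭ k) ≅⟨ ∘-resp-≅ ≅-refl (ρ-no _ ♭k≢m₀) ⟩
          rs f k ∘ id      ≈⟨ identityʳ ⟩
          rs f k           ≅⟨ ≅-sym (ρ'-no k ♭k≢m₀) ⟩
          ρ' k             ∎

      v≈v' : ZMapEq C v v'
      v≈v' = cartesian-lifts-unique {f = f} cart (λ x≤y → x≤y) {h = h} v v' v-lifts v'-lifts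

  fibreLimits⇒cartesian : (∀ j → IsIso C (ss f j)) → (∀ m → IsFibreLimit m) → IsCartesian C f
  fibreLimits⇒cartesian ss-iso lim {n'} X' u u-mono h = v , v-lifts , v-unique
    where
    open ≅-Reasoning

    flat-face∘u : ∀ k → flat (λ j → face i (u j)) k ≡ flat u (♭ k)
    flat-face∘u = flat-∘ u (face i) (λ {a} {b} → punchIn-mono-≤ i a b)

    h-cone : ∀ m → FibreCone m (R X' (flat u m))
    h-cone m = record
      { leg          = λ k p →
          subst (λ c → Hom (R X' c) (R B k)) (trans (flat-face∘u k) (cong (flat u) p)) (rs h k)
      ; leg-commutes = λ p p' → ≅⇒≈ (begin
          fwd B i ∘ _              ≅⟨ ∘-resp-≅ ≅-refl (subst-≅ (R X') (λ _ → R B _) _ _) ⟩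
          fwd B i ∘ rs h (inject₁ i) ≅⟨ DomEq⇒≅ (empty h i (λ j → punchInᵢ≢i i (u j))) ⟩
          bwd B i ∘ rs h (suc i)     ≅⟨ ∘-resp-≅ ≅-refl (≅-sym (subst-≅ (R X') (λ _ → R B _) _ _)) ⟩
          bwd B i ∘ _              ∎)
      }

    leg-≅ : ∀ {m} k (p : ♭ k ≡ m) → leg (h-cone m) k p ≅ rs h k
    leg-≅ k p = subst-≅ (R X') (λ _ → R B k) _ (rs h k)

    ρ : ∀ m → Hom (R X' (flat u m)) (R A m)
    ρ m = proj₁ (lim m (h-cone m))

    ρ-factors : ∀ m → Factors (ρ m) (h-cone m)
    ρ-factors m = proj₁ (proj₂ (lim m (h-cone m)))

    ρ-carries-square : ∀ {j' x y} (e : ♭ y ≡ x)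
                       {a : Hom (R A x) (S A j')} {b : Hom (R B y) (S B (face i j'))} →
                       ss f j' ∘ a ≈ b ∘ slice y e → (ss f j' ∘ (a ∘ ρ x)) ≅ (b ∘ rs h y)
    ρ-carries-square {j'} {x} {y} e {a} {b} sq = begin
      ss f j' ∘ (a ∘ ρ x)       ≈⟨ ≈.sym assoc ⟩
      (ss f j' ∘ a) ∘ ρ x       ≈⟨ ∘-resp-≈ sq ≈.refl ⟩
      (b ∘ slice y e) ∘ ρ x     ≈⟨ assoc ⟩
      b ∘ (slice y e ∘ ρ x)     ≈⟨ ∘-resp-≈ ≈.refl (ρ-factors x y e) ⟩
      b ∘ leg (h-cone x) y e ≅⟨ ∘-resp-≅ ≅-refl (leg-≅ y e) ⟩
      b ∘ rs h y                 ∎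

    τ : ∀ j → Hom (S X' j) (S A (u j))
    τ j = proj₁ (ss-iso (u j)) ∘ ss h j

    ss-f∘τ : ∀ j {W} (c : Hom W (S X' j)) → ss f (u j) ∘ (τ j ∘ c) ≈ ss h j ∘ c
    ss-f∘τ j c = ≈.trans (≈.sym assoc) (∘-resp-≈ (iso-cancelˡ (ss-iso (u j)) (ss h j)) ≈.refl)

    τ-square : ∀ j {x y z} (e : ♭ y ≡ x) {a b} → ss f (u j) ∘ a ≈ b ∘ slice y e →
                  (c : Hom (R X' z) (S X' j)) → (ss h j ∘ c) ≅ (b ∘ rs h y) → (τ j ∘ c) ≅ (a ∘ ρ x)
    τ-square j e {a} {b} sq c h-sq = iso-monic-≅ (ss-iso (u j)) ≅-refl (begin
      ss f (u j) ∘ (τ j ∘ c) ≈⟨ ss-f∘τ j c ⟩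
      ss h j ∘ c             ≅⟨ h-sq ⟩
      b ∘ rs h _             ≅⟨ ≅-sym (ρ-carries-square e sq) ⟩
      ss f (u j) ∘ (a ∘ ρ _) ∎)

    v-first : ∀ j → (∀ j' → j' < j → u j' ≢ u j) →
              DomEq C {F = R X'} (τ j ∘ fwd X' j) (fwd A (u j) ∘ ρ (inject₁ (u j)))
    v-first j below = ≅⇒DomEq
      (trans (proj₁ h-first) (trans (flat-face∘u _) (cong (flat u) (flat-face-inject₁-face i (u j)))))
      (τ-square j _ (fwd-square (u j)) (fwd X' j) (DomEq⇒≅ h-first))
      where
      h-first : DomEq C {F = R X'} (ss h j ∘ fwd X' j)
                                   (fwd B (face i (u j)) ∘ rs h (inject₁ (face i (u j))))
      h-first = first h j λ j' j'<j eq → below j' j'<j (punchIn-injective i _ _ eq)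

    v-last : ∀ j → (∀ j' → j < j' → u j' ≢ u j) →
             DomEq C {F = R X'} (τ j ∘ bwd X' j) (bwd A (u j) ∘ ρ (suc (u j)))
    v-last j above = ≅⇒DomEq
      (trans (proj₁ h-last) (trans (flat-face∘u _) (cong (flat u) (flat-face-suc-face i (u j)))))
      (τ-square j _ (bwd-square (u j)) (bwd X' j) (DomEq⇒≅ h-last))
      where
      h-last : DomEq C {F = R X'} (ss h j ∘ bwd X' j)
                                  (bwd B (face i (u j)) ∘ rs h (suc (face i (u j))))
      h-last = last h j λ j' j<j' eq → above j' j<j' (punchIn-injective i _ _ eq)

    v-mid : ∀ j k → toℕ k ≡ suc (toℕ j) → u j ≡ u k →
            IxEq C {F = R X'} {G = S A} (τ j ∘ bwd X' j) (τ k ∘ fwd X' k)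
    v-mid j k k≡1+j uj≡uk = ≅⇒IxEq (proj₁ h-mid) uj≡uk
      (iso-monic-≅ (ss-iso (u j)) (≅-cong (S A) (λ x → S B (face i x)) (ss f) uj≡uk) (begin
        ss f (u j) ∘ (τ j ∘ bwd X' j) ≈⟨ ss-f∘τ j _ ⟩
        ss h j ∘ bwd X' j             ≅⟨ IxEq⇒≅ h-mid ⟩
        ss h k ∘ fwd X' k             ≈⟨ ≈.sym (ss-f∘τ k _) ⟩
        ss f (u k) ∘ (τ k ∘ fwd X' k) ∎))
      where
      h-mid : IxEq C {F = R X'} {G = S B} (ss h j ∘ bwd X' j) (ss h k ∘ fwd X' k)
      h-mid = mid h j k k≡1+j (cong (face i) uj≡uk)

    v-empty : ∀ m → (∀ j → u j ≢ m) →
              DomEq C {F = R X'} (fwd A m ∘ ρ (inject₁ m)) (bwd A m ∘ ρ (suc m))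
    v-empty m m∉ = ≅⇒DomEq
      (trans (sym (trans (flat-face∘u _) (cong (flat u) (flat-face-inject₁-face i m))))
             (trans (proj₁ h-gap) (trans (flat-face∘u _) (cong (flat u) (flat-face-suc-face i m)))))
      (iso-monic-≅ (ss-iso m) ≅-refl (begin
        ss f m ∘ (fwd A m ∘ ρ (inject₁ m))     ≅⟨ ρ-carries-square _ (fwd-square m) ⟩
        fwd B (face i m) ∘ rs h (inject₁ (face i m)) ≅⟨ DomEq⇒≅ h-gap ⟩
        bwd B (face i m) ∘ rs h (suc (face i m))     ≅⟨ ≅-sym (ρ-carries-square _ (bwd-square m)) ⟩
        ss f m ∘ (bwd A m ∘ ρ (suc m))         ∎))
      where
      h-gap : DomEq C {F = R X'} (fwd B (face i m) ∘ rs h (inject₁ (face i m)))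
                                 (bwd B (face i m) ∘ rs h (suc (face i m)))
      h-gap = empty h (face i m) λ j eq → m∉ j (punchIn-injective i _ _ eq)

    v : ZMap C X' A u
    v = record
      { mono = u-mono ; rs = ρ ; ss = τ
      ; first = v-first ; last = v-last ; mid = v-mid ; empty = v-empty }

    v-lifts : CompEq C f v h
    v-lifts = (λ j → iso-cancelˡ (ss-iso (u j)) (ss h j))
            , λ k → ≅⇒DomEq (sym (flat-face∘u k)) (begin
                rs f k ∘ ρ (♭ k)             ≈⟨ ρ-factors (♭ k) k refl ⟩
                leg (h-cone (♭ k)) k refl ≅⟨ leg-≅ k refl ⟩
                rs h k                        ∎)

    lift-factors : ∀ (v' : ZMap C X' A u) → CompEq C f v' h → ∀ m → Factors (rs v' m) (h-cone m)
    lift-factors v' v'-lifts m k p = ≅⇒≈ (begin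
      slice k p ∘ rs v' m    ≅⟨ ∘-resp-≅ (slice-≅ k p) (≅-cong _ (R A) (rs v') (sym p)) ⟩
      rs f k ∘ rs v' (♭ k)   ≅⟨ DomEq⇒≅ (proj₂ v'-lifts k) ⟩
      rs h k                 ≅⟨ ≅-sym (leg-≅ k p) ⟩
      leg (h-cone m) k p ∎)

    v-unique : ∀ v' → CompEq C f v' h → ZMapEq C v v'
    v-unique v' v'-lifts =
      (λ m → fibreLimit-unique (lim m) (h-cone m) (ρ-factors m) (lift-factors v' v'-lifts m)) ,
      (λ j → iso-monic (ss-iso (u j)) (≈.trans (proj₁ v-lifts j) (≈.sym (proj₁ v'-lifts j))))

lemma4p1 : ∀ {o ℓ e} (C : Category o ℓ e) (n : ℕ) (i : Fin (suc n))
    (A : Zigzag C n) (B : Zigzag C (suc n)) (f : ZMap C A B (face i)) →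
    IsCartesian C f ⇔
      ((∀ (j : Fin n) → IsIso C (ZMap.ss f j)) ×
       (∀ (k : Fin (suc (suc n))) → k ≢ inject₁ i → k ≢ suc i → IsIso C (ZMap.rs f k)) ×
       Σ (flat (face i) (inject₁ i) ≡ flat (face i) (suc i)) λ eq →
         IsPullback C (Zigzag.fwd B i) (Zigzag.bwd B i)
           (subst (λ c → Category.Hom C (Zigzag.R A c) (Zigzag.R B (inject₁ i))) eq
             (ZMap.rs f (inject₁ i)))
           (ZMap.rs f (suc i)))
lemma4p1 C n i A B f = mk⇔
  (λ (cart : IsCartesian C f) →
    let ss-iso = cartesian⇒ss-iso cart
        lim    = cartesian⇒fibreLimit cart ss-iso
    in ss-iso
     , (λ k k≢i k≢1+i → fibreLimit⇒iso (flat-face-injective-off i k≢i k≢1+i) (lim _))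
     , flat-face-inject₁≡suc i
     , fibreLimit⇒pullback (flat-face-inject₁≡suc i) (lim _))
  (λ (ss-iso , isos , eq , pb) → fibreLimits⇒cartesian ss-iso (fibreLimits isos eq pb))
  where open FaceMap C i f
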